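{- Let $p\ge2$. For any ultimately periodic set $U\subseteq\mathbb{N}$, the binary relation $S_U(x,y)$, which holds iff $x=p^r$ and $y=p^{r+u}$ for some $r\ge0$ and $u\in U$, is definable in existential Büchi arithmetic of base $p$.
   Context: A set $U\subseteq\mathbb{N}$ is ultimately periodic if there are $t\ge0$, $\ell>0$ such that for all $n\ge t$, $n\in U\iff n+\ell\in U$. Büchi arithmetic of base $p$ is the first-order theory of $\langle\mathbb{N},0,1,+,V_p\rangle$, where $V_p(a,b)$ holds iff $a$ is the largest power of $p$ dividing $b$, and $V_p(a,0)$ never holds. A relation is definable in existential Büchi arithmetic if it equals the set of tuples satisfying some existential formula (existential quantifiers followed by a quantifier-free formula). -}

module Defs where

open import Data.Nat using (ℕ; zero; suc; _+_; _*_; _^_; _≤_; _<_)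
open import Data.Nat.Divisibility using (_∣_)
open import Data.Fin using (Fin; zero; suc)
open import Data.Bool using (Bool; true)
open import Data.Product using (Σ; ∃; _×_; _,_)
open import Data.Sum using (_⊎_)
open import Relation.Nullary using (¬_)
open import Relation.Binary.PropositionalEquality using (_≡_)
open import Function.Bundles using (_⇔_)

UltimatelyPeriodic : (ℕ → Bool) → Set
UltimatelyPeriodic U =
  Σ ℕ λ t → Σ ℕ λ ℓ → (0 < ℓ) × (∀ n → t ≤ n → (U n ≡ true ⇔ U (n + ℓ) ≡ true))

V : ℕ → ℕ → ℕ → Set
V p a b = ¬ (b ≡ 0) × (Σ ℕ λ r → a ≡ p ^ r) × (a ∣ b) × ¬ (p * a ∣ b)

data Term (n : ℕ) : Set where
  var  : Fin n → Term n
  `0   : Term n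
  `1   : Term n
  _`+_ : Term n → Term n → Term n

data QF (n : ℕ) : Set where
  _`≡_ : Term n → Term n → QF n
  `V   : Term n → Term n → QF n
  `¬   : QF n → QF n
  _`∧_ : QF n → QF n → QF n
  _`∨_ : QF n → QF n → QF n

⟦_⟧t : ∀ {n} → Term n → (Fin n → ℕ) → ℕ
⟦ var i ⟧t ρ = ρ i
⟦ `0 ⟧t ρ = 0
⟦ `1 ⟧t ρ = 1
⟦ s `+ t ⟧t ρ = ⟦ s ⟧t ρ + ⟦ t ⟧t ρ

Sat : (p : ℕ) → ∀ {n} → QF n → (Fin n → ℕ) → Set
Sat p (s `≡ t) ρ = ⟦ s ⟧t ρ ≡ ⟦ t ⟧t ρ
Sat p (`V s t) ρ = V p (⟦ s ⟧t ρ) (⟦ t ⟧t ρ)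
Sat p (`¬ φ) ρ = ¬ Sat p φ ρ
Sat p (φ `∧ ψ) ρ = Sat p φ ρ × Sat p ψ ρ
Sat p (φ `∨ ψ) ρ = Sat p φ ρ ⊎ Sat p ψ ρ

env2 : ∀ {k} → ℕ → ℕ → (Fin k → ℕ) → Fin (2 + k) → ℕ
env2 x y w zero = x
env2 x y w (suc zero) = y
env2 x y w (suc (suc i)) = w i

ExDefinable₂ : ℕ → (ℕ → ℕ → Set) → Set
ExDefinable₂ p R =
  Σ ℕ λ k → Σ (QF (2 + k)) λ φ →
    ∀ x y → (R x y ⇔ (Σ (Fin k → ℕ) λ w → Sat p φ (env2 x y w)))

S : ℕ → (ℕ → Bool) → ℕ → ℕ → Set
S p U x y = Σ ℕ λ r → Σ ℕ λ u → (U u ≡ true) × (x ≡ p ^ r) × (y ≡ p ^ (r + u))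

-- Fix a period ℓ of U from threshold t and put q = p ^ ℓ. For x a power of p, "z = x · qᵐ for
-- some m" is existential: z is a power of p and q·w + x = w + z for some w with w = 0 or
-- V_p(x, w). The witness is w = x · (1 + q + ⋯ + qᵐ⁻¹); conversely, writing w = k·x and
-- z = x·pᵈ, the equation becomes q·k + 1 = k + pᵈ, which forces ℓ ∣ d. So S_U is the finite
-- union of the relations y = pᵘ·x (u < t, u ∈ U) and y = p^(t+j)·z with z ∈ x·q^ℕ (j < ℓ, t+j ∈ U).

module Submission where

open import Defs
open import Data.Nat using (ℕ; zero; suc; _+_; _*_; _∸_; _^_; _≤_; _<_; NonZero; >-nonZero; >-nonZero⁻¹; z≤n; s≤s)
open import Data.Nat.Properties
open import Data.Nat.Divisibility using (_∣_; divides; _∣0; ∣-refl; ∣-trans; ∣⇒≤; ∣1⇒≡1; m∣m*n; n∣m*n; ∣m∣n⇒∣m+n; ∣m+n∣m⇒∣n; *-cancelˡ-∣)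
open import Data.Nat.DivMod using (_/_; _%_; m%n<n; m≡m%n+[m/n]*n)
open import Data.Nat.Induction using (<-wellFounded)
open import Data.Nat.Tactic.RingSolver using (solve-∀)
open import Data.Bool using (Bool; true; false)
open import Data.Fin using (Fin; zero; suc)
open import Data.Product using (∃; ∃₂; _×_; _,_)
open import Data.Sum using (_⊎_; inj₁; inj₂)
open import Relation.Nullary using (¬_; yes; no; contradiction)
open import Relation.Binary.PropositionalEquality
open import Induction.WellFounded using (Acc; acc)
open import Function.Bundles using (_⇔_; mk⇔; Equivalence)
open import Function.Construct.Composition using (_⇔-∘_)
open import Function.Construct.Identity using (⇔-id)

open Equivalence using (to; from)

infixr 25 _·_

_·_ : ∀ {n} → ℕ → Term n → Term n
zero  · t = `0
suc c · t = t `+ c · t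

⟦·⟧t : ∀ {n} c (t : Term n) ρ → ⟦ c · t ⟧t ρ ≡ c * ⟦ t ⟧t ρ
⟦·⟧t zero    t ρ = refl
⟦·⟧t (suc c) t ρ = cong (⟦ t ⟧t ρ +_) (⟦·⟧t c t ρ)

⊥ᶠ : ∀ {n} → QF n
⊥ᶠ = `1 `≡ `0

when : ∀ {n} → Bool → QF n → QF n
when true  φ = φ
when false φ = ⊥ᶠ

Sat-when : ∀ {p n} b (φ : QF n) ρ → Sat p (when b φ) ρ ⇔ (b ≡ true × Sat p φ ρ)
Sat-when true  φ ρ = mk⇔ (refl ,_) (λ (_ , s) → s)
Sat-when false φ ρ = mk⇔ (λ ()) (λ ())

⋁ : ∀ {n} → ℕ → (ℕ → QF n) → QF n
⋁ zero    φ = ⊥ᶠ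
⋁ (suc N) φ = ⋁ N φ `∨ φ N

Sat-⋁ : ∀ {p n} N (φ : ℕ → QF n) ρ → Sat p (⋁ N φ) ρ ⇔ ∃ λ i → i < N × Sat p (φ i) ρ
Sat-⋁ N φ ρ = mk⇔ (elim N) (λ (i , i<N , s) → intro N i i<N s)
  where
  elim : ∀ N → Sat _ (⋁ N φ) ρ → ∃ λ i → i < N × Sat _ (φ i) ρ
  elim (suc N) (inj₁ s) with elim N s
  ... | i , i<N , s′ = i , m≤n⇒m≤1+n i<N , s′
  elim (suc N) (inj₂ s) = N , ≤-refl , s
  intro : ∀ N i → i < N → Sat _ (φ i) ρ → Sat _ (⋁ N φ) ρ
  intro (suc N) i i<1+N s with m<1+n⇒m<n∨m≡n i<1+N
  ... | inj₁ i<N  = inj₁ (intro N i i<N s)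
  ... | inj₂ refl = inj₂ s

^-swap : ∀ m a b → m ^ a * m ^ b ≡ m ^ (b + a)
^-swap m a b = trans (sym (^-distribˡ-+-* m a b)) (cong (m ^_) (+-comm a b))

repunit : ℕ → ℕ → ℕ
repunit q zero    = 0
repunit q (suc m) = 1 + q * repunit q m

repunit-telescope : ∀ q m → q * repunit q m + 1 ≡ repunit q m + q ^ m
repunit-telescope q zero    = cong (_+ 1) (*-zeroʳ q)
repunit-telescope q (suc m) = begin
  q * (1 + q * g) + 1    ≡⟨ expand q g ⟩
  1 + q * (q * g + 1)    ≡⟨ cong (λ v → 1 + q * v) (repunit-telescope q m) ⟩
  1 + q * (g + q ^ m)    ≡⟨ cong suc (*-distribˡ-+ q g (q ^ m)) ⟩
  1 + q * g + q * q ^ m  ∎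
  where
  open ≡-Reasoning
  g : ℕ
  g = repunit q m
  expand : ∀ q g → q * (1 + q * g) + 1 ≡ 1 + q * (q * g + 1)
  expand = solve-∀

module Powers (p : ℕ) (1<p : 1 < p) where

  instance
    p≢0 : NonZero p
    p≢0 = >-nonZero (<-trans (s≤s z≤n) 1<p)

  p∤1 : ¬ p ∣ 1
  p∤1 p∣1 = <-irrefl (sym (∣1⇒≡1 p∣1)) 1<p

  p∣p^ : ∀ n .{{_ : NonZero n}} → p ∣ p ^ n
  p∣p^ (suc n) = m∣m*n (p ^ n)

  ^-cancelˡ-≤ : ∀ {r s} → p ^ r ≤ p ^ s → r ≤ s
  ^-cancelˡ-≤ p^r≤p^s = ≮⇒≥ (λ s<r → <⇒≱ (^-monoʳ-< p 1<p s<r) p^r≤p^s)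

  ^≡1⇒≡0 : ∀ {d} → p ^ d ≡ 1 → d ≡ 0
  ^≡1⇒≡0 {d} p^d≡1 with m^n≡1⇒n≡0∨m≡1 p d p^d≡1
  ... | inj₁ d≡0 = d≡0
  ... | inj₂ p≡1 = contradiction p≡1 (>⇒≢ 1<p)

  V-^* : ∀ r {c} → ¬ p ∣ c → V p (p ^ r) (p ^ r * c)
  V-^* r {c} p∤c = p^r*c≢0 , (r , refl) , m∣m*n c , p*p^r∤p^r*c
    where
    p^r*c≢0 : ¬ p ^ r * c ≡ 0
    p^r*c≢0 eq = p∤c (subst (p ∣_) (sym c≡0) (p ∣0))
      where
      c≡0 : c ≡ 0
      c≡0 = m*n≡0⇒m≡0 c (p ^ r) {{m^n≢0 p r}} (trans (*-comm c (p ^ r)) eq)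
    p*p^r∤p^r*c : ¬ p * p ^ r ∣ p ^ r * c
    p*p^r∤p^r*c h =
      p∤c (*-cancelˡ-∣ (p ^ r) {{m^n≢0 p r}} (subst (_∣ p ^ r * c) (*-comm p (p ^ r)) h))

  V-^ : ∀ r → V p (p ^ r) (p ^ r)
  V-^ r = subst (V p (p ^ r)) (*-identityʳ (p ^ r)) (V-^* r p∤1)

  module Scale (ℓ : ℕ) .{{ℓ≢0 : NonZero ℓ}} where

    q : ℕ
    q = p ^ ℓ

    instance
      q≢0 : NonZero q
      q≢0 = m^n≢0 p ℓ

    q≤p^d : ∀ {k₀ d} → q + q * k₀ ≡ k₀ + p ^ d → q ≤ p ^ d
    q≤p^d {k₀} {d} eq = +-cancelʳ-≤ k₀ q (p ^ d) (begin
      q + k₀      ≤⟨ +-monoʳ-≤ q (m≤n*m k₀ q) ⟩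
      q + q * k₀  ≡⟨ eq ⟩
      k₀ + p ^ d  ≡⟨ +-comm k₀ (p ^ d) ⟩
      p ^ d + k₀  ∎)
      where open ≤-Reasoning

    cancel-q : ∀ {k₀ P} → q + q * k₀ ≡ k₀ + q * P → ∃ λ k → q * k + 1 ≡ k + P
    cancel-q {k₀} {P} eq with ∣m+n∣m⇒∣n q∣q*P+k₀ (m∣m*n P)
      where
      q∣q*P+k₀ : q ∣ q * P + k₀
      q∣q*P+k₀ = subst (q ∣_) (trans eq (+-comm k₀ (q * P))) (∣m∣n⇒∣m+n ∣-refl (m∣m*n k₀))
    ... | divides k refl = k , *-cancelˡ-≡ (q * k + 1) (k + P) q (begin
      q * (q * k + 1)  ≡⟨ lhs q k ⟩
      q + q * (k * q)  ≡⟨ eq ⟩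
      k * q + q * P    ≡⟨ rhs q k P ⟩
      q * (k + P)      ∎)
      where
      open ≡-Reasoning
      lhs : ∀ q k → q * (q * k + 1) ≡ q + q * (k * q)
      lhs = solve-∀
      rhs : ∀ q k P → k * q + q * P ≡ q * (k + P)
      rhs = solve-∀

    descend : ∀ {k₀ d} → q + q * k₀ ≡ k₀ + p ^ d →
              ∃₂ λ k d′ → d ≡ ℓ + d′ × q * k + 1 ≡ k + p ^ d′
    descend {d = d} eq with m≤n⇒∃[o]m+o≡n {ℓ} {d} (^-cancelˡ-≤ (q≤p^d {d = d} eq))
    ... | d′ , refl with cancel-q (trans eq (cong (_ +_) (^-distribˡ-+-* p ℓ d′)))
    ... | k , eq′ = k , d′ , refl , eq′

    q*k+1≡k+p^d⇒ℓ∣d : ∀ {k d} → q * k + 1 ≡ k + p ^ d → ℓ ∣ d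
    q*k+1≡k+p^d⇒ℓ∣d {k} {d} = go k (<-wellFounded d)
      where
      unfold : ∀ q k₀ → suc (q + q * k₀) ≡ q * suc k₀ + 1
      unfold = solve-∀
      go : ∀ k {d} → Acc _<_ d → q * k + 1 ≡ k + p ^ d → ℓ ∣ d
      go zero {d} _ eq = subst (ℓ ∣_) (sym (^≡1⇒≡0 (sym 1≡p^d))) (ℓ ∣0)
        where
        1≡p^d : 1 ≡ p ^ d
        1≡p^d = trans (cong (_+ 1) (sym (*-zeroʳ q))) eq
      -- k = 1 + q·k′ and d = ℓ + d′, and the equation holds again for k′ and d′.
      go (suc k₀) {d} (acc rec) eq with descend {d = d} (suc-injective (trans (unfold q k₀) eq))
      ... | k , d′ , refl , eq′ = ∣m∣n⇒∣m+n ∣-refl (go k (rec (m<n+m d′ (>-nonZero⁻¹ ℓ))) eq′)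

    ∣w⇒∣z : ∀ {x z w} → x ∣ w → q * w + x ≡ w + z → x ∣ z
    ∣w⇒∣z {x} x∣w eq = ∣m+n∣m⇒∣n (subst (x ∣_) eq (∣m∣n⇒∣m+n (∣-trans x∣w (n∣m*n q)) ∣-refl)) x∣w

    cancel-p^r : ∀ {r k d} → q * (k * p ^ r) + p ^ r ≡ k * p ^ r + p ^ (r + d) →
                 q * k + 1 ≡ k + p ^ d
    cancel-p^r {r} {k} {d} eq = *-cancelʳ-≡ (q * k + 1) (k + p ^ d) (p ^ r) {{m^n≢0 p r}} (begin
      (q * k + 1) * p ^ r        ≡⟨ lhs q k (p ^ r) ⟩
      q * (k * p ^ r) + p ^ r    ≡⟨ eq ⟩
      k * p ^ r + p ^ (r + d)    ≡⟨ cong (k * p ^ r +_) (^-distribˡ-+-* p r d) ⟩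
      k * p ^ r + p ^ r * p ^ d  ≡⟨ rhs k (p ^ r) (p ^ d) ⟩
      (k + p ^ d) * p ^ r        ∎)
      where
      open ≡-Reasoning
      lhs : ∀ q k x → (q * k + 1) * x ≡ q * (k * x) + x
      lhs = solve-∀
      rhs : ∀ k x P → k * x + x * P ≡ (k + P) * x
      rhs = solve-∀

    scaled-sound : ∀ {x z w} → V p x x → V p z z → x ∣ w → q * w + x ≡ w + z →
                   ∃₂ λ r m → x ≡ p ^ r × z ≡ p ^ (r + m * ℓ)
    scaled-sound (_ , (r , refl) , _) (_ , (s , refl) , _) x∣w eq
      with m≤n⇒∃[o]m+o≡n {r} {s} (^-cancelˡ-≤ (∣⇒≤ {{m^n≢0 p s}} (∣w⇒∣z x∣w eq))) | x∣w
    ... | d , refl | divides k refl with q*k+1≡k+p^d⇒ℓ∣d {k} {d} (cancel-p^r {r} eq)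
    ... | divides m refl = r , m , refl , refl

    repunit-0∨V : ∀ r m → p ^ r * repunit q m ≡ 0 ⊎ V p (p ^ r) (p ^ r * repunit q m)
    repunit-0∨V r zero    = inj₁ (*-zeroʳ (p ^ r))
    repunit-0∨V r (suc m) = inj₂ (V-^* r p∤1+q*g)
      where
      p∤1+q*g : ¬ p ∣ 1 + q * repunit q m
      p∤1+q*g p∣1+q*g =
        p∤1 (∣m+n∣m⇒∣n (subst (p ∣_) (+-comm 1 _) p∣1+q*g) (∣-trans (p∣p^ ℓ) (m∣m*n _)))

    repunit-equation : ∀ r m →
      q * (p ^ r * repunit q m) + p ^ r ≡ p ^ r * repunit q m + p ^ (r + m * ℓ)
    repunit-equation r m = begin
      q * (x * g) + x          ≡⟨ factor q x g ⟩
      x * (q * g + 1)          ≡⟨ cong (x *_) (repunit-telescope q m) ⟩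
      x * (g + q ^ m)          ≡⟨ *-distribˡ-+ x g (q ^ m) ⟩
      x * g + x * q ^ m        ≡⟨ cong (λ v → x * g + x * v) (^-*-assoc p ℓ m) ⟩
      x * g + x * p ^ (ℓ * m)  ≡⟨ cong (λ e → x * g + x * p ^ e) (*-comm ℓ m) ⟩
      x * g + x * p ^ (m * ℓ)  ≡⟨ cong (x * g +_) (^-distribˡ-+-* p r (m * ℓ)) ⟨
      x * g + p ^ (r + m * ℓ)  ∎
      where
      open ≡-Reasoning
      x g : ℕ
      x = p ^ r
      g = repunit q m
      factor : ∀ q x g → q * (x * g) + x ≡ x * (q * g + 1)
      factor = solve-∀

module Periodic (U : ℕ → Bool) (t ℓ : ℕ)
  (per : ∀ n → t ≤ n → (U n ≡ true ⇔ U (n + ℓ) ≡ true)) where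

  U-shift : ∀ m {n} → t ≤ n → U n ≡ true ⇔ U (n + m * ℓ) ≡ true
  U-shift zero    {n} _   = subst (λ v → U n ≡ true ⇔ U v ≡ true) (sym (+-identityʳ n)) (⇔-id _)
  U-shift (suc m) {n} t≤n = one-period ⇔-∘ U-shift m t≤n
    where
    one-period : U (n + m * ℓ) ≡ true ⇔ U (n + (ℓ + m * ℓ)) ≡ true
    one-period = subst (λ v → U (n + m * ℓ) ≡ true ⇔ U v ≡ true)
      (trans (+-assoc n (m * ℓ) ℓ) (cong (n +_) (+-comm (m * ℓ) ℓ)))
      (per (n + m * ℓ) (≤-trans t≤n (m≤m+n n (m * ℓ))))

residue : ∀ t ℓ .{{_ : NonZero ℓ}} {u} → t ≤ u → ∃₂ λ j m → j < ℓ × u ≡ t + j + m * ℓ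
residue t ℓ {u} t≤u = j , m , m%n<n (u ∸ t) ℓ , (begin
  u                ≡⟨ m+[n∸m]≡n t≤u ⟨
  t + (u ∸ t)      ≡⟨ cong (t +_) (m≡m%n+[m/n]*n (u ∸ t) ℓ) ⟩
  t + (j + m * ℓ)  ≡⟨ +-assoc t j (m * ℓ) ⟨
  t + j + m * ℓ    ∎)
  where
  open ≡-Reasoning
  j m : ℕ
  j = (u ∸ t) % ℓ
  m = (u ∸ t) / ℓ

`x `y `z `w : Term 4
`x = var zero
`y = var (suc zero)
`z = var (suc (suc zero))
`w = var (suc (suc (suc zero)))

scaled-by-power : ℕ → QF 4
scaled-by-power q =
  `V `x `x `∧ (`V `z `z `∧ (((`w `≡ `0) `∨ `V `x `w) `∧ ((q · `w `+ `x) `≡ (`w `+ `z))))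

S-formula : ℕ → (ℕ → Bool) → ℕ → ℕ → QF 4
S-formula p U t ℓ =
  ⋁ t (λ u → when (U u) (`V `x `x `∧ (`y `≡ (p ^ u) · `x)))
  `∨ ⋁ ℓ (λ j → when (U (t + j)) (scaled-by-power (p ^ ℓ) `∧ (`y `≡ (p ^ (t + j)) · `z)))

0∨V⇒∣ : ∀ {p x w} → w ≡ 0 ⊎ V p x w → x ∣ w
0∨V⇒∣ {x = x} (inj₁ refl)            = x ∣0
0∨V⇒∣         (inj₂ (_ , _ , x∣w , _)) = x∣w

module Definability (p : ℕ) (1<p : 1 < p) (U : ℕ → Bool) (t ℓ : ℕ) .{{_ : NonZero ℓ}}
  (per : ∀ n → t ≤ n → (U n ≡ true ⇔ U (n + ℓ) ≡ true)) where

  open Powers p 1<p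
  open Scale ℓ
  open Periodic U t ℓ per

  φ : QF 4
  φ = S-formula p U t ℓ

  shift-exponent : ∀ a r b → p ^ a * p ^ (r + b) ≡ p ^ (r + (a + b))
  shift-exponent a r b = trans (^-swap p a (r + b)) (cong (p ^_) (rearrange r b a))
    where
    rearrange : ∀ r b a → r + b + a ≡ r + (a + b)
    rearrange = solve-∀

  sound : ∀ x y ws → Sat p φ (env2 x y ws) → S p U x y
  sound x y ws (inj₁ s) with to (Sat-⋁ t _ _) s
  ... | u , _ , s′ with to (Sat-when (U u) _ _) s′
  ... | Uu , (_ , (r , refl) , _) , y≡ =
    r , u , Uu , refl , trans y≡ (trans (⟦·⟧t (p ^ u) `x _) (^-swap p u r))
  sound x y ws (inj₂ s) with to (Sat-⋁ ℓ _ _) s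
  ... | j , _ , s′ with to (Sat-when (U (t + j)) _ _) s′
  ... | Utj , (Vx , Vz , w≡0∨V , eq) , y≡
      with scaled-sound Vx Vz (0∨V⇒∣ w≡0∨V) (trans (sym (cong (_+ x) (⟦·⟧t q `w _))) eq)
  ... | r , m , refl , z≡ =
    r , t + j + m * ℓ , to (U-shift m (m≤m+n t j)) Utj , refl , (begin
      y                              ≡⟨ y≡ ⟩
      ⟦ (p ^ (t + j)) · `z ⟧t _        ≡⟨ ⟦·⟧t (p ^ (t + j)) `z _ ⟩
      p ^ (t + j) * ws zero          ≡⟨ cong (p ^ (t + j) *_) z≡ ⟩
      p ^ (t + j) * p ^ (r + m * ℓ)  ≡⟨ shift-exponent (t + j) r (m * ℓ) ⟩
      p ^ (r + (t + j + m * ℓ))      ∎)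
    where open ≡-Reasoning

  complete : ∀ x y → S p U x y → ∃ λ ws → Sat p φ (env2 x y ws)
  complete _ _ (r , u , Uu , refl , refl) with u <? t
  ... | yes u<t = (λ _ → 0) , inj₁ (from (Sat-⋁ t _ _) (u , u<t , from (Sat-when (U u) _ _)
      (Uu , V-^ r , sym (trans (⟦·⟧t (p ^ u) `x _) (^-swap p u r)))))
  ... | no u≮t with residue t ℓ (≮⇒≥ u≮t)
  ... | j , m , j<ℓ , refl = ws , inj₂ (from (Sat-⋁ ℓ _ _) (j , j<ℓ , from (Sat-when (U (t + j)) _ _)
      (from (U-shift m (m≤m+n t j)) Uu , (V-^ r , V-^ (r + m * ℓ) , repunit-0∨V r m , equation) , y≡)))
    where
    ws : Fin 2 → ℕ
    ws zero       = p ^ (r + m * ℓ)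
    ws (suc zero) = p ^ r * repunit q m
    ρ : Fin 4 → ℕ
    ρ = env2 (p ^ r) (p ^ (r + (t + j + m * ℓ))) ws
    equation : ⟦ q · `w ⟧t ρ + p ^ r ≡ p ^ r * repunit q m + p ^ (r + m * ℓ)
    equation = trans (cong (_+ p ^ r) (⟦·⟧t q `w _)) (repunit-equation r m)
    y≡ : p ^ (r + (t + j + m * ℓ)) ≡ ⟦ (p ^ (t + j)) · `z ⟧t ρ
    y≡ = sym (trans (⟦·⟧t (p ^ (t + j)) `z _) (shift-exponent (t + j) r (m * ℓ)))

lemma6 : (p : ℕ) → 2 ≤ p → (U : ℕ → Bool) → UltimatelyPeriodic U →
    ExDefinable₂ p (S p U)
lemma6 p 1<p U (t , ℓ , 0<ℓ , per) =
  2 , φ , λ x y → mk⇔ (complete x y) (λ (ws , s) → sound x y ws s)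
  where open Definability p 1<p U t ℓ {{>-nonZero 0<ℓ}} per
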